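{- Let $p\neq2$ be a prime and $\mathbb O$ Zorn's split octonion algebra over $\mathbb Q_p$. Let $\Lambda$ be the set of all $\begin{pmatrix} x_1 & \langle x_2,x_3,x_4\rangle\\ \langle x_5,x_6,x_7\rangle & x_8\end{pmatrix}$ with $x_2,x_6\in p\mathbb Z_p$ and all other $x_i\in\mathbb Z_p$. Then $\Lambda$ is an order in $\mathbb O$ satisfying (a) $\Lambda\subsetneq\Lambda^*\subsetneq p^{ -1}\Lambda$ and (b) $\Lambda^{*2}\subseteq p^{ -1}\Lambda$.
   Context: Zorn's octonion algebra $\mathbb O$ over $\mathbb Q_p$: formal matrices $\begin{pmatrix} a & \vec v\\ \vec w & d\end{pmatrix}$, $a,d\in\mathbb Q_p$, $\vec v,\vec w\in\mathbb Q_p^3$, with multiplication $\begin{pmatrix} a & \vec v\\ \vec w & d\end{pmatrix}\begin{pmatrix} \alpha & \vec\phi\\ \vec\psi & \delta\end{pmatrix}=\begin{pmatrix} a\alpha+\vec v\circ\vec\psi & a\vec\phi+\delta\vec v-\vec w\times\vec\psi\\ \alpha\vec w+\delta\vec\psi+\vec v\times\vec\phi & d\delta+\vec w\circ\vec\phi\end{pmatrix}$ and trace $T\begin{pmatrix} a & \vec v\\ \vec w & d\end{pmatrix}=a+d$. A lattice is a finitely generated $\mathbb Z_p$-submodule $\Lambda$ with $\Lambda\otimes\mathbb Q_p=\mathbb O$; an order is a lattice that is a subring containing the identity. The dual lattice is $\Lambda^*=\{x\in\mathbb O:T(xy)\in\mathbb Z_p\ \forall y\in\Lambda\}$, and $\Lambda^{*2}$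 denotes the $\mathbb Z_p$-module generated by all products $xy$ with $x,y\in\Lambda^*$. -}

module Defs where

open import Data.Nat using (ℕ; zero; suc; _+_; _*_; _∸_; _^_; NonZero)
open import Data.Nat.Properties using (m^n≢0)
open import Data.Nat.DivMod using (_/_; _mod_)
open import Data.Fin using (Fin; toℕ)
open import Data.Vec using (Vec; []; _∷_)
open import Data.Vec.Relation.Unary.All using (All)
open import Data.Product using (Σ; ∃; _×_; _,_)
open import Relation.Binary.PropositionalEquality using (_≡_)
open import Relation.Nullary using (¬_)

module Zorn (p : ℕ) .{{nz : NonZero p}} where

  -- p-adic integers ℤ_p as digit sequences  a = Σ_i (a i) p^i
  Zp : Set
  Zp = ℕ → Fin p

  trunc : Zp → ℕ → ℕ
  trunc a zero    = 0
  trunc a (suc n) = trunc a n + toℕ (a n) * p ^ n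

  -- the p-adic integer whose residue mod p^m is (F m mod p^m),
  -- provided F m ≡ F (suc m) mod p^m (digit n = ⌊F(n+1)/p^n⌋ mod p)
  fromResidues : (ℕ → ℕ) → Zp
  fromResidues F n = _/_ (F (suc n)) (p ^ n) {{m^n≢0 p n}} mod p

  _≈ᶻ_ : Zp → Zp → Set
  a ≈ᶻ b = ∀ n → a n ≡ b n

  ℕ→Zp : ℕ → Zp
  ℕ→Zp c = fromResidues (λ _ → c)

  _+ᶻ_ : Zp → Zp → Zp
  a +ᶻ b = fromResidues (λ m → trunc a m + trunc b m)

  _*ᶻ_ : Zp → Zp → Zp
  a *ᶻ b = fromResidues (λ m → trunc a m * trunc b m)

  -ᶻ_ : Zp → Zp
  -ᶻ a = fromResidues (λ m → p ^ m ∸ trunc a m)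

  -- ℚ_p as the localisation ℤ_p[1/p]:  (k , a) represents p^{-k} a
  record Qp : Set where
    constructor _/p^_
    field
      num : Zp
      ex  : ℕ

  _≈_ : Qp → Qp → Set
  (a /p^ k) ≈ (b /p^ l) = (ℕ→Zp (p ^ l) *ᶻ a) ≈ᶻ (ℕ→Zp (p ^ k) *ᶻ b)

  _⊕_ : Qp → Qp → Qp
  (a /p^ k) ⊕ (b /p^ l) = ((ℕ→Zp (p ^ l) *ᶻ a) +ᶻ (ℕ→Zp (p ^ k) *ᶻ b)) /p^ (k + l)

  _⊗_ : Qp → Qp → Qp
  (a /p^ k) ⊗ (b /p^ l) = (a *ᶻ b) /p^ (k + l)

  ⊖_ : Qp → Qp
  ⊖ (a /p^ k) = (-ᶻ a) /p^ k

  _⊟_ : Qp → Qp → Qp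
  x ⊟ y = x ⊕ (⊖ y)

  ι : Zp → Qp
  ι a = a /p^ 0

  0q 1q pq : Qp
  0q = ι (ℕ→Zp 0)
  1q = ι (ℕ→Zp 1)
  pq = ι (ℕ→Zp p)

  InZp : Qp → Set
  InZp x = Σ Zp λ b → x ≈ ι b

  InPZp : Qp → Set
  InPZp x = Σ Zp λ b → x ≈ ι (ℕ→Zp p *ᶻ b)

  record V3 : Set where
    constructor ⟨_,_,_⟩
    field
      c₁ c₂ c₃ : Qp

  _∘_ : V3 → V3 → Qp
  ⟨ x₁ , x₂ , x₃ ⟩ ∘ ⟨ y₁ , y₂ , y₃ ⟩ = ((x₁ ⊗ y₁) ⊕ (x₂ ⊗ y₂)) ⊕ (x₃ ⊗ y₃)

  _×v_ : V3 → V3 → V3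
  ⟨ x₁ , x₂ , x₃ ⟩ ×v ⟨ y₁ , y₂ , y₃ ⟩ =
    ⟨ (x₂ ⊗ y₃) ⊟ (x₃ ⊗ y₂) , (x₃ ⊗ y₁) ⊟ (x₁ ⊗ y₃) , (x₁ ⊗ y₂) ⊟ (x₂ ⊗ y₁) ⟩

  _+v_ : V3 → V3 → V3
  ⟨ x₁ , x₂ , x₃ ⟩ +v ⟨ y₁ , y₂ , y₃ ⟩ = ⟨ x₁ ⊕ y₁ , x₂ ⊕ y₂ , x₃ ⊕ y₃ ⟩

  -v_ : V3 → V3
  -v ⟨ x₁ , x₂ , x₃ ⟩ = ⟨ ⊖ x₁ , ⊖ x₂ , ⊖ x₃ ⟩

  _·v_ : Qp → V3 → V3
  c ·v ⟨ x₁ , x₂ , x₃ ⟩ = ⟨ c ⊗ x₁ , c ⊗ x₂ , c ⊗ x₃ ⟩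

  _≈v_ : V3 → V3 → Set
  ⟨ x₁ , x₂ , x₃ ⟩ ≈v ⟨ y₁ , y₂ , y₃ ⟩ = (x₁ ≈ y₁) × (x₂ ≈ y₂) × (x₃ ≈ y₃)

  -- the octonion  ( a  v )
  --               ( w  d )
  record 𝕆 : Set where
    constructor [_,_,_,_]
    field
      a : Qp
      v : V3
      w : V3
      d : Qp

  _≈ₒ_ : 𝕆 → 𝕆 → Set
  [ a , v , w , d ] ≈ₒ [ α , φ , ψ , δ ] = (a ≈ α) × (v ≈v φ) × (w ≈v ψ) × (d ≈ δ)

  _*ₒ_ : 𝕆 → 𝕆 → 𝕆
  [ a , v , w , d ] *ₒ [ α , φ , ψ , δ ] =
    [ (a ⊗ α) ⊕ (v ∘ ψ)
    , ((a ·v φ) +v (δ ·v v)) +v (-v (w ×v ψ))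
    , ((α ·v w) +v (δ ·v ψ)) +v (v ×v φ)
    , (d ⊗ δ) ⊕ (w ∘ φ) ]

  _+ₒ_ : 𝕆 → 𝕆 → 𝕆
  [ a , v , w , d ] +ₒ [ α , φ , ψ , δ ] = [ a ⊕ α , v +v φ , w +v ψ , d ⊕ δ ]

  _·ₒ_ : Qp → 𝕆 → 𝕆
  c ·ₒ [ a , v , w , d ] = [ c ⊗ a , c ·v v , c ·v w , c ⊗ d ]

  0ₒ 1ₒ : 𝕆
  0ₒ = [ 0q , ⟨ 0q , 0q , 0q ⟩ , ⟨ 0q , 0q , 0q ⟩ , 0q ]
  1ₒ = [ 1q , ⟨ 0q , 0q , 0q ⟩ , ⟨ 0q , 0q , 0q ⟩ , 1q ]

  T : 𝕆 → Qp
  T [ a , v , w , d ] = a ⊕ d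

  lincomb : ∀ {n} → Vec Qp n → Vec 𝕆 n → 𝕆
  lincomb []       []       = 0ₒ
  lincomb (c ∷ cs) (g ∷ gs) = (c ·ₒ g) +ₒ lincomb cs gs

  Subset : Set₁
  Subset = 𝕆 → Set

  _⊆_ : Subset → Subset → Set
  A ⊆ B = ∀ x → A x → B x

  _⊊_ : Subset → Subset → Set
  A ⊊ B = (A ⊆ B) × ∃ λ x → B x × ¬ A x

  Zpmap : ∀ {n} → Vec Zp n → Vec Qp n
  Zpmap []       = []
  Zpmap (c ∷ cs) = ι c ∷ Zpmap cs

  IsSubmodule : Subset → Set
  IsSubmodule Λ =
    (∀ x y → x ≈ₒ y → Λ x → Λ y) ×
    Λ 0ₒ ×
    (∀ x y → Λ x → Λ y → Λ (x +ₒ y)) ×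
    (∀ (c : Zp) x → Λ x → Λ (ι c ·ₒ x))

  IsLattice : Subset → Set
  IsLattice Λ =
    IsSubmodule Λ ×
    Σ ℕ λ n → Σ (Vec 𝕆 n) λ gs →
      All Λ gs ×
      (∀ x → Λ x → Σ (Vec Zp n) λ cs → x ≈ₒ lincomb (Zpmap cs) gs) ×
      (∀ x → Σ (Vec Qp n) λ cs → x ≈ₒ lincomb cs gs)

  IsOrder : Subset → Set
  IsOrder Λ = IsLattice Λ × Λ 1ₒ × (∀ x y → Λ x → Λ y → Λ (x *ₒ y))

  Dual : Subset → Subset
  Dual Λ x = ∀ y → Λ y → InZp (T (x *ₒ y))

  DualSq : Subset → Subset
  DualSq Λ z =
    Σ ℕ λ n → Σ (Vec 𝕆 n) λ xs → Σ (Vec 𝕆 n) λ ys → Σ (Vec Zp n) λ cs →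
      All (Dual Λ) xs × All (Dual Λ) ys × (z ≈ₒ lincomb (Zpmap cs) (prods xs ys))
    where
      prods : ∀ {n} → Vec 𝕆 n → Vec 𝕆 n → Vec 𝕆 n
      prods []       []       = []
      prods (x ∷ xs) (y ∷ ys) = (x *ₒ y) ∷ prods xs ys

  pInv : Subset → Subset
  pInv Λ x = Λ (pq ·ₒ x)

  Λ₀ : Subset
  Λ₀ [ x₁ , ⟨ x₂ , x₃ , x₄ ⟩ , ⟨ x₅ , x₆ , x₇ ⟩ , x₈ ] =
    InZp x₁ × InPZp x₂ × InZp x₃ × InZp x₄ ×
    InZp x₅ × InPZp x₆ × InZp x₇ × InZp x₈

-- Λ₀, its dual and p⁻¹Λ₀ are diagonal lattices ("boxes"): the i-th coordinate ranges over s_i ℤ_p for a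
-- vector s of scales in {p⁻¹, 1, p}.  The trace form pairs coordinate σ(j) of x with coordinate j of y,
-- T(xy) = Σ_j x_σ(j) y_j, so the dual of the box with scales s is the box with scales 1/s_σ(j); for Λ₀
-- this is Λ₀* = box(1, 1, p⁻¹, 1, p⁻¹, 1, 1, 1).  The inclusions in (a) and their strictness are read
-- off coordinatewise from the scales (p⁻¹ ∉ ℤ_p), while closure of Λ₀ under multiplication and (b)
-- follow by checking, for each coordinate of Zorn's product, which fractional ideal every product
-- x_i y_j lies in.  Equalities in ℚ_p = ℤ_p[1/p] are verified on residues modulo p^m.

module Submission where

open import Algebra.Bundles using (CommutativeRing; CommutativeMonoid)
import Algebra.Consequences.Setoid as Consequences
open import Algebra.Core using (Op₂)
import Algebra.Properties.CommutativeSemigroup as CommutativeSemigroupProperties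
import Algebra.Properties.Ring as RingProperties
open import Algebra.Structures using (IsCommutativeMonoid)
open import Data.Empty using (⊥-elim)
open import Data.Fin using (Fin; zero; suc; toℕ)
open import Data.Fin.Patterns using (0F; 1F; 2F; 3F; 4F; 5F; 6F; 7F)
import Data.Fin.Properties as Fin
open import Data.Integer using (ℤ; +_; -[1+_]; _+_; _*_; -_)
import Data.Integer.Properties as ℤ
open import Data.Integer.Tactic.RingSolver using (solve-∀)
open import Data.Nat as ℕ using (ℕ; zero; suc; NonZero)
import Data.Nat.DivMod as DivMod
open import Data.Nat.DivMod using (m≡m%n+[m/n]*n; m%n<n; m∣n⇒o%n%m≡o%m; m%[n*o]/o≡m/o%n; n%1≡0)
open import Data.Nat.Divisibility using (n∣m*n)
open import Data.Nat.Primality using (Prime; prime⇒nonTrivial)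
import Data.Nat.Properties as ℕ
open import Data.Product using (Σ; ∃; ∃₂; _×_; _,_; proj₁; proj₂)
open import Data.Vec using (Vec; []; _∷_; lookup; tabulate)
import Data.Vec.Properties as Vec
open import Data.Vec.Relation.Unary.All as All using (All; []; _∷_)
open import Data.Vec.Relation.Unary.All.Properties using (tabulate⁺)
open import Level using (0ℓ)
open import Relation.Binary.Bundles using (Setoid)
open import Relation.Binary.Core using (Rel)
open import Relation.Binary.PropositionalEquality hiding ([_])
import Relation.Binary.Reasoning.Setoid as SetoidReasoning
open import Relation.Nullary using (¬_; contradiction)

open import Defs

-- Congruences modulo n

infix 4 _≡_mod_

record _≡_mod_ (x y : ℤ) (n : ℕ) : Set where
  constructor ≡-mod
  field
    quotient : ℤ
    identity : x ≡ y + quotient * + n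

module _ {n : ℕ} where

  mod-refl : ∀ {x} → x ≡ x mod n
  mod-refl {x} = ≡-mod (+ 0) (lemma x (+ n))
    where lemma : ∀ x n → x ≡ x + + 0 * n
          lemma = solve-∀

  mod-reflexive : ∀ {x y} → x ≡ y → x ≡ y mod n
  mod-reflexive refl = mod-refl

  mod-sym : ∀ {x y} → x ≡ y mod n → y ≡ x mod n
  mod-sym {y = y} (≡-mod k refl) = ≡-mod (- k) (lemma y k (+ n))
    where lemma : ∀ y k n → y ≡ (y + k * n) + (- k) * n
          lemma = solve-∀

  mod-trans : ∀ {x y z} → x ≡ y mod n → y ≡ z mod n → x ≡ z mod n
  mod-trans {z = z} (≡-mod k refl) (≡-mod l refl) = ≡-mod (l + k) (lemma z l k (+ n))
    where lemma : ∀ z l k n → (z + l * n) + k * n ≡ z + (l + k) * n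
          lemma = solve-∀

  mod-+ : ∀ {x y u v} → x ≡ y mod n → u ≡ v mod n → x + u ≡ y + v mod n
  mod-+ {y = y} {v = v} (≡-mod k refl) (≡-mod l refl) = ≡-mod (k + l) (lemma y v k l (+ n))
    where lemma : ∀ y v k l n → (y + k * n) + (v + l * n) ≡ (y + v) + (k + l) * n
          lemma = solve-∀

  mod-* : ∀ {x y u v} → x ≡ y mod n → u ≡ v mod n → x * u ≡ y * v mod n
  mod-* {y = y} {v = v} (≡-mod k refl) (≡-mod l refl) =
    ≡-mod (k * v + y * l + k * l * + n) (lemma y v k l (+ n))
    where lemma : ∀ y v k l n → (y + k * n) * (v + l * n) ≡ y * v + (k * v + y * l + k * l * n) * n
          lemma = solve-∀

  mod-neg : ∀ {x y} → x ≡ y mod n → - x ≡ - y mod n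
  mod-neg {y = y} (≡-mod k refl) = ≡-mod (- k) (lemma y k (+ n))
    where lemma : ∀ y k n → - (y + k * n) ≡ - y + (- k) * n
          lemma = solve-∀

  multiple≡0 : ∀ k → k * + n ≡ + 0 mod n
  multiple≡0 k = ≡-mod k (lemma k (+ n))
    where lemma : ∀ k n → k * n ≡ + 0 + k * n
          lemma = solve-∀

mod-weaken : ∀ m {n x y} → x ≡ y mod m ℕ.* n → x ≡ y mod n
mod-weaken m {n} {y = y} (≡-mod k refl) = ≡-mod (k * + m) (cong (λ t → y + t) (begin
  k * + (m ℕ.* n)   ≡⟨ cong (k *_) (ℤ.pos-* m n) ⟩
  k * (+ m * + n)   ≡⟨ ℤ.*-assoc k (+ m) (+ n) ⟨
  k * + m * + n     ∎))
  where open ≡-Reasoning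

%-mod : ∀ k n .{{_ : NonZero n}} → + (k ℕ.% n) ≡ + k mod n
%-mod k n = mod-sym (≡-mod (+ (k ℕ./ n)) (begin
  + k                              ≡⟨ cong +_ (m≡m%n+[m/n]*n k n) ⟩
  + (k ℕ.% n ℕ.+ k ℕ./ n ℕ.* n)    ≡⟨ ℤ.pos-+ (k ℕ.% n) _ ⟩
  + (k ℕ.% n) + + (k ℕ./ n ℕ.* n)  ≡⟨ cong (λ t → + (k ℕ.% n) + t) (ℤ.pos-* (k ℕ./ n) n) ⟩
  + (k ℕ.% n) + + (k ℕ./ n) * + n  ∎))
  where open ≡-Reasoning

private
  below-modulus : ∀ {n x y k} → x ℕ.< n → + x ≢ + y + + suc k * + n
  below-modulus {n} {x} {y} {k} x<n eq = ℕ.<⇒≱ x<n (begin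
    n                    ≤⟨ ℕ.m≤m+n n (k ℕ.* n) ⟩
    n ℕ.+ k ℕ.* n        ≤⟨ ℕ.m≤n+m _ y ⟩
    y ℕ.+ suc k ℕ.* n    ≡⟨ ℤ.+-injective (trans eq (sym +-pos)) ⟨
    x                    ∎)
    where
    open ℕ.≤-Reasoning
    +-pos : + (y ℕ.+ suc k ℕ.* n) ≡ + y + + suc k * + n
    +-pos = trans (ℤ.pos-+ y _) (cong (λ t → + y + t) (ℤ.pos-* (suc k) n))

mod-injective : ∀ {n x y} → x ℕ.< n → y ℕ.< n → + x ≡ + y mod n → x ≡ y
mod-injective {n} {x} {y} _ _ (≡-mod (+ zero) eq) = ℤ.+-injective (trans eq (ℤ.+-identityʳ (+ y)))
mod-injective x<n _ (≡-mod (+ suc k) eq) = ⊥-elim (below-modulus {k = k} x<n eq)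
mod-injective {n} {x} {y} _ y<n (≡-mod -[1+ k ] eq) =
  ⊥-elim (below-modulus {k = k} y<n (swap (+ x) (+ y) (+ suc k) (+ n) eq))
  where swap : ∀ x y k n → x ≡ y + (- k) * n → y ≡ x + k * n
        swap x y k n refl = lemma y k n
          where lemma : ∀ y k n → y ≡ (y + (- k) * n) + k * n
                lemma = solve-∀

mod-setoid : ℕ → Setoid 0ℓ 0ℓ
mod-setoid n = record
  { Carrier       = ℤ
  ; _≈_           = λ x y → x ≡ y mod n
  ; isEquivalence = record { refl = mod-refl ; sym = mod-sym ; trans = mod-trans }
  }

mod-cancel : ∀ {k} c .{{c≢0 : NonZero c}} {x y} → + c * x ≡ + c * y mod c ℕ.* k → x ≡ y mod k
mod-cancel {k} c {{c≢0}} {x} {y} (≡-mod q eq) = ≡-mod q (ℤ.*-cancelˡ-≡ (+ c) x (y + q * + k) {{c≢0}} (begin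
  + c * x                    ≡⟨ eq ⟩
  + c * y + q * + (c ℕ.* k)  ≡⟨ cong (λ t → + c * y + q * t) (ℤ.pos-* c k) ⟩
  + c * y + q * (+ c * + k)  ≡⟨ lemma (+ c) y q (+ k) ⟩
  + c * (y + q * + k)        ∎))
  where
  open ≡-Reasoning
  lemma : ∀ c y q k → c * y + q * (c * k) ≡ c * (y + q * k)
  lemma = solve-∀

module _ (p : ℕ) .{{_ : NonZero p}} where
  open Zorn p

  -- Residues of p-adic integers

  Residue : ℕ → Zp → ℤ → Set
  Residue m a z = + trunc a m ≡ z mod p ℕ.^ m

  Coherent : (ℕ → ℕ) → Set
  Coherent F = ∀ m → + F (suc m) ≡ + F m mod p ℕ.^ m

  trunc-< : ∀ a m → trunc a m ℕ.< p ℕ.^ m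
  trunc-< a zero    = ℕ.s≤s ℕ.z≤n
  trunc-< a (suc m) = ℕ.≤-trans (ℕ.+-monoˡ-≤ (toℕ (a m) ℕ.* p ℕ.^ m) (trunc-< a m))
                                 (ℕ.*-monoˡ-≤ (p ℕ.^ m) (Fin.toℕ<n (a m)))

  trunc-coherent : ∀ a → Coherent (trunc a)
  trunc-coherent a m = ≡-mod (+ toℕ (a m))
    (trans (ℤ.pos-+ (trunc a m) _) (cong (λ t → + trunc a m + t) (ℤ.pos-* (toℕ (a m)) (p ℕ.^ m))))

  residue-fromResidues : ∀ {F} → Coherent F → ∀ m → Residue m (fromResidues F) (+ F m)
  residue-fromResidues {F} coh m = subst (λ t → + t ≡ + F m mod p ℕ.^ m) (sym (trunc≡% m))
                                         (%-mod (F m) (p ℕ.^ m) {{ℕ.m^n≢0 p m}})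
    where
    _%p^_ : ℕ → ℕ → ℕ
    k %p^ m = ℕ._%_ k (p ℕ.^ m) {{ℕ.m^n≢0 p m}}

    trunc≡% : ∀ m → trunc (fromResidues F) m ≡ F m %p^ m
    trunc≡% zero    = sym (n%1≡0 (F 0))
    trunc≡% (suc m) = begin
      trunc (fromResidues F) m ℕ.+ toℕ (F (suc m) ℕ./ p ℕ.^ m DivMod.mod p) ℕ.* p ℕ.^ m
        ≡⟨ cong₂ (λ u v → u ℕ.+ v ℕ.* p ℕ.^ m) (trunc≡% m) (Fin.toℕ-fromℕ< (m%n<n (F (suc m) ℕ./ p ℕ.^ m) p)) ⟩
      F m %p^ m ℕ.+ (F (suc m) ℕ./ p ℕ.^ m) ℕ.% p ℕ.* p ℕ.^ m
        ≡⟨ cong (λ u → u ℕ.+ (F (suc m) ℕ./ p ℕ.^ m) ℕ.% p ℕ.* p ℕ.^ m) same-residue ⟩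
      F (suc m) %p^ m ℕ.+ (F (suc m) ℕ./ p ℕ.^ m) ℕ.% p ℕ.* p ℕ.^ m
        ≡⟨ split ⟨
      F (suc m) %p^ suc m ∎
      where
      open ≡-Reasoning
      instance
        _ = ℕ.m^n≢0 p m
        _ = ℕ.m^n≢0 p (suc m)
      same-residue : F m %p^ m ≡ F (suc m) %p^ m
      same-residue = mod-injective (m%n<n _ _) (m%n<n _ _)
        (mod-trans (%-mod (F m) _) (mod-trans (mod-sym (coh m)) (mod-sym (%-mod (F (suc m)) _))))
      split : F (suc m) %p^ suc m ≡ F (suc m) %p^ m ℕ.+ (F (suc m) ℕ./ p ℕ.^ m) ℕ.% p ℕ.* p ℕ.^ m
      split = trans (m≡m%n+[m/n]*n (F (suc m) %p^ suc m) (p ℕ.^ m))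
        (cong₂ (λ u v → u ℕ.+ v ℕ.* p ℕ.^ m)
          (m∣n⇒o%n%m≡o%m (p ℕ.^ m) (p ℕ.^ suc m) (F (suc m)) (n∣m*n p))
          (m%[n*o]/o≡m/o%n (F (suc m)) p (p ℕ.^ m)))

  residue-ℕ : ∀ c m → Residue m (ℕ→Zp c) (+ c)
  residue-ℕ c = residue-fromResidues (λ _ → mod-refl)

  residue-+ : ∀ {a b z z'} m → Residue m a z → Residue m b z' → Residue m (a +ᶻ b) (z + z')
  residue-+ {a} {b} {z} {z'} m ha hb = mod-trans (residue-fromResidues coherent m)
    (subst (λ t → t ≡ z + z' mod p ℕ.^ m) (sym (ℤ.pos-+ (trunc a m) (trunc b m))) (mod-+ ha hb))
    where
    coherent : Coherent (λ m → trunc a m ℕ.+ trunc b m)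
    coherent m = subst₂ (λ s t → s ≡ t mod p ℕ.^ m)
      (sym (ℤ.pos-+ (trunc a (suc m)) (trunc b (suc m)))) (sym (ℤ.pos-+ (trunc a m) (trunc b m)))
                        (mod-+ (trunc-coherent a m) (trunc-coherent b m))

  residue-* : ∀ {a b z z'} m → Residue m a z → Residue m b z' → Residue m (a *ᶻ b) (z * z')
  residue-* {a} {b} {z} {z'} m ha hb = mod-trans (residue-fromResidues coherent m)
    (subst (λ t → t ≡ z * z' mod p ℕ.^ m) (sym (ℤ.pos-* (trunc a m) (trunc b m))) (mod-* ha hb))
    where
    coherent : Coherent (λ m → trunc a m ℕ.* trunc b m)
    coherent m = subst₂ (λ s t → s ≡ t mod p ℕ.^ m)
      (sym (ℤ.pos-* (trunc a (suc m)) (trunc b (suc m)))) (sym (ℤ.pos-* (trunc a m) (trunc b m)))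
                        (mod-* (trunc-coherent a m) (trunc-coherent b m))

  residue-neg : ∀ {a z} m → Residue m a z → Residue m (-ᶻ a) (- z)
  residue-neg {a} {z} m ha = mod-trans (residue-fromResidues coherent m)
    (subst (λ t → t ≡ - z mod p ℕ.^ m) (sym (complement a m))
      (subst (λ t → + p ℕ.^ m + - + trunc a m ≡ t mod p ℕ.^ m) (ℤ.+-identityˡ (- z))
        (mod-+ (p^m≡0 m) (mod-neg ha))))
    where
    -- p^m ∸ trunc a m never truncates, by trunc-<
    complement : ∀ a m → + (p ℕ.^ m ℕ.∸ trunc a m) ≡ + p ℕ.^ m + - + trunc a m
    complement a m = trans (sym (ℤ.⊖-≥ (ℕ.<⇒≤ (trunc-< a m)))) (sym (ℤ.m-n≡m⊖n (p ℕ.^ m) (trunc a m)))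
    p^m≡0 : ∀ m → + p ℕ.^ m ≡ + 0 mod p ℕ.^ m
    p^m≡0 m = subst (λ t → t ≡ + 0 mod p ℕ.^ m) (ℤ.*-identityˡ _) (multiple≡0 (+ 1))
    coherent : Coherent (λ m → p ℕ.^ m ℕ.∸ trunc a m)
    coherent m = subst₂ (λ s t → s ≡ t mod p ℕ.^ m) (sym (complement a (suc m))) (sym (complement a m))
      (mod-+ (mod-trans (mod-weaken p (p^m≡0 (suc m))) (mod-sym (p^m≡0 m))) (mod-neg (trunc-coherent a m)))

  trunc-cong : ∀ {a b} → a ≈ᶻ b → ∀ m → trunc a m ≡ trunc b m
  trunc-cong a≈b zero    = refl
  trunc-cong a≈b (suc m) = cong₂ (λ u v → u ℕ.+ toℕ v ℕ.* p ℕ.^ m) (trunc-cong a≈b m) (a≈b m)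

  ≈ᶻ-from-residues : ∀ {a b} → (∀ m → ∃ λ z → Residue m a z × Residue m b z) → a ≈ᶻ b
  ≈ᶻ-from-residues {a} {b} h n = Fin.toℕ-injective
    (ℕ.*-cancelʳ-≡ _ _ (p ℕ.^ n) {{ℕ.m^n≢0 p n}}
      (ℕ.+-cancelˡ-≡ (trunc a n) _ _ (trans (trunc≡ (suc n)) (cong (λ t → t ℕ.+ toℕ (b n) ℕ.* p ℕ.^ n) (sym (trunc≡ n))))))
    where
    trunc≡ : ∀ m → trunc a m ≡ trunc b m
    trunc≡ m = let (z , ra , rb) = h m in
      mod-injective (trunc-< a m) (trunc-< b m) (mod-trans ra (mod-sym rb))

  trunc-descends : ∀ a j m → + trunc a (j ℕ.+ m) ≡ + trunc a m mod p ℕ.^ m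
  trunc-descends a zero    m = mod-refl
  trunc-descends a (suc j) m = mod-trans
    (mod-weaken (p ℕ.^ j) (subst (λ n → + trunc a (suc j ℕ.+ m) ≡ + trunc a (j ℕ.+ m) mod n)
                                  (ℕ.^-distribˡ-+-* p j m) (trunc-coherent a (j ℕ.+ m))))
    (trunc-descends a j m)

  -- ℚ_p as a commutative ring

  open Qp

  private
    ⌊_⌋ : Qp → ℕ → ℤ
    ⌊ x ⌋ m = + trunc (num x) m

  P^ : ℕ → ℤ
  P^ k = + (p ℕ.^ k)

  P^-+ : ∀ k l → P^ (k ℕ.+ l) ≡ P^ k * P^ l
  P^-+ k l = trans (cong +_ (ℕ.^-distribˡ-+-* p k l)) (ℤ.pos-* (p ℕ.^ k) (p ℕ.^ l))

  -- _≈_ is defined by matching on both arguments, so the wrapper lets Agda infer them.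
  infix 4 _≃_
  record _≃_ (x y : Qp) : Set where
    constructor mk≃
    field ≈-of : x ≈ y
  open _≃_ public

  ≃-by-residues : ∀ {x y} →
    (∀ m → ∃₂ λ z z' → Residue m (num x) z × Residue m (num y) z' × P^ (ex y) * z ≡ P^ (ex x) * z' mod p ℕ.^ m) →
    x ≃ y
  ≃-by-residues {x} {y} h = mk≃ (≈ᶻ-from-residues λ m →
    let (z , z' , rx , ry , e) = h m in
    P^ (ex y) * z , residue-* m (residue-ℕ _ m) rx , mod-trans (residue-* m (residue-ℕ _ m) ry) (mod-sym e))

  ≃-by-identity : ∀ {x y} (Py Px : ℤ) → P^ (ex y) ≡ Py → P^ (ex x) ≡ Px →
    (∀ m → ∃₂ λ z z' → Residue m (num x) z × Residue m (num y) z' × Py * z ≡ Px * z') →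
    x ≃ y
  ≃-by-identity Py Px refl refl h = ≃-by-residues λ m →
    let (z , z' , rx , ry , e) = h m in z , z' , rx , ry , mod-reflexive e

  ≃-residues : ∀ {x y} → x ≃ y → ∀ m → P^ (ex y) * ⌊ x ⌋ m ≡ P^ (ex x) * ⌊ y ⌋ m mod p ℕ.^ m
  ≃-residues {x} {y} (mk≃ x≈y) m = mod-trans (mod-sym (residue-* m (residue-ℕ _ m) mod-refl))
    (mod-trans (mod-reflexive (cong +_ (trunc-cong x≈y m))) (residue-* m (residue-ℕ _ m) mod-refl))

  residue-⊕ : ∀ x y {z z'} m → Residue m (num x) z → Residue m (num y) z' →
              Residue m (num (x ⊕ y)) (P^ (ex y) * z + P^ (ex x) * z')
  residue-⊕ x y m rx ry = residue-+ m (residue-* m (residue-ℕ _ m) rx) (residue-* m (residue-ℕ _ m) ry)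

  ≃-refl : ∀ {x} → x ≃ x
  ≃-refl {x} = ≃-by-residues λ m → _ , _ , mod-refl , mod-refl , mod-refl

  ≃-reflexive : ∀ {x y} → x ≡ y → x ≃ y
  ≃-reflexive refl = ≃-refl

  ≃-sym : ∀ {x y} → x ≃ y → y ≃ x
  ≃-sym x≃y = ≃-by-residues λ m → _ , _ , mod-refl , mod-refl , mod-sym (≃-residues x≃y m)

  ≃-trans : ∀ {x y z} → x ≃ y → y ≃ z → x ≃ z
  ≃-trans {x} {y} {z} x≃y y≃z = ≃-by-residues λ m →
    ⌊ x ⌋ (ex y ℕ.+ m) , ⌊ z ⌋ (ex y ℕ.+ m) ,
    mod-sym (trunc-descends (num x) (ex y) m) , mod-sym (trunc-descends (num z) (ex y) m) ,
    mod-cancel (p ℕ.^ ex y) {{ℕ.m^n≢0 p (ex y)}} (scaled m)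
    where
    -- the exponent of y is cancelled by working at precision p^(ex y + m)
    scaled : ∀ m → let a = P^ (ex x) ; b = P^ (ex y) ; c = P^ (ex z)
                       tx = ⌊ x ⌋ (ex y ℕ.+ m) ; tz = ⌊ z ⌋ (ex y ℕ.+ m) in
             b * (c * tx) ≡ b * (a * tz) mod p ℕ.^ ex y ℕ.* p ℕ.^ m
    scaled m = subst (λ n → b * (c * tx) ≡ b * (a * tz) mod n) (ℕ.^-distribˡ-+-* p (ex y) m) (begin
      b * (c * tx)  ≡⟨ swap b c tx ⟩
      c * (b * tx)  ≈⟨ mod-* (mod-refl {x = c}) (≃-residues x≃y (ex y ℕ.+ m)) ⟩
      c * (a * ty)  ≡⟨ swap c a ty ⟩
      a * (c * ty)  ≈⟨ mod-* (mod-refl {x = a}) (≃-residues y≃z (ex y ℕ.+ m)) ⟩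
      a * (b * tz)  ≡⟨ swap a b tz ⟩
      b * (a * tz)  ∎)
      where
      open SetoidReasoning (mod-setoid (p ℕ.^ (ex y ℕ.+ m)))
      a = P^ (ex x) ; b = P^ (ex y) ; c = P^ (ex z)
      tx = ⌊ x ⌋ (ex y ℕ.+ m) ; ty = ⌊ y ⌋ (ex y ℕ.+ m) ; tz = ⌊ z ⌋ (ex y ℕ.+ m)
      swap : ∀ a b t → a * (b * t) ≡ b * (a * t)
      swap = solve-∀

  ⊕-cong : ∀ {x x' y y'} → x ≃ x' → y ≃ y' → x ⊕ y ≃ x' ⊕ y'
  ⊕-cong {x} {x'} {y} {y'} x≃x' y≃y' = ≃-by-residues λ m →
    let a = P^ (ex x) ; b = P^ (ex y) ; a' = P^ (ex x') ; b' = P^ (ex y')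
        tx = ⌊ x ⌋ m ; ty = ⌊ y ⌋ m ; tx' = ⌊ x' ⌋ m ; ty' = ⌊ y' ⌋ m
        open SetoidReasoning (mod-setoid (p ℕ.^ m)) in
    _ , _ , residue-⊕ x y m mod-refl mod-refl , residue-⊕ x' y' m mod-refl mod-refl , (begin
      P^ (ex x' ℕ.+ ex y') * (b * tx + a * ty)  ≡⟨ cong (_* (b * tx + a * ty)) (P^-+ (ex x') (ex y')) ⟩
      a' * b' * (b * tx + a * ty)               ≡⟨ spread a b a' b' tx ty ⟩
      b' * b * (a' * tx) + a' * a * (b' * ty)   ≈⟨ mod-+ (mod-* (mod-refl {x = b' * b}) (≃-residues x≃x' m))
                                                          (mod-* (mod-refl {x = a' * a}) (≃-residues y≃y' m)) ⟩
      b' * b * (a * tx') + a' * a * (b * ty')   ≡⟨ gather a b a' b' tx' ty' ⟩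
      a * b * (b' * tx' + a' * ty')             ≡⟨ cong (_* (b' * tx' + a' * ty')) (P^-+ (ex x) (ex y)) ⟨
      P^ (ex x ℕ.+ ex y) * (b' * tx' + a' * ty') ∎)
    where
    spread : ∀ a b a' b' u v → a' * b' * (b * u + a * v) ≡ b' * b * (a' * u) + a' * a * (b' * v)
    spread = solve-∀
    gather : ∀ a b a' b' u v → b' * b * (a * u) + a' * a * (b * v) ≡ a * b * (b' * u + a' * v)
    gather = solve-∀

  ⊗-cong : ∀ {x x' y y'} → x ≃ x' → y ≃ y' → x ⊗ y ≃ x' ⊗ y'
  ⊗-cong {x} {x'} {y} {y'} x≃x' y≃y' = ≃-by-residues λ m →
    let a = P^ (ex x) ; b = P^ (ex y) ; a' = P^ (ex x') ; b' = P^ (ex y')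
        tx = ⌊ x ⌋ m ; ty = ⌊ y ⌋ m ; tx' = ⌊ x' ⌋ m ; ty' = ⌊ y' ⌋ m
        open SetoidReasoning (mod-setoid (p ℕ.^ m)) in
    _ , _ , residue-* m mod-refl mod-refl , residue-* m mod-refl mod-refl , (begin
      P^ (ex x' ℕ.+ ex y') * (tx * ty)  ≡⟨ cong (_* (tx * ty)) (P^-+ (ex x') (ex y')) ⟩
      a' * b' * (tx * ty)               ≡⟨ interchange a' b' tx ty ⟩
      a' * tx * (b' * ty)               ≈⟨ mod-* (≃-residues x≃x' m) (≃-residues y≃y' m) ⟩
      a * tx' * (b * ty')               ≡⟨ interchange a b tx' ty' ⟨
      a * b * (tx' * ty')               ≡⟨ cong (_* (tx' * ty')) (P^-+ (ex x) (ex y)) ⟨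
      P^ (ex x ℕ.+ ex y) * (tx' * ty')  ∎)
    where
    interchange : ∀ a b u v → a * b * (u * v) ≡ a * u * (b * v)
    interchange = solve-∀

  ⊖-cong : ∀ {x x'} → x ≃ x' → ⊖ x ≃ ⊖ x'
  ⊖-cong {x} {x'} x≃x' = ≃-by-residues λ m →
    _ , _ , residue-neg m mod-refl , residue-neg m mod-refl ,
    subst₂ (λ s t → s ≡ t mod p ℕ.^ m) (ℤ.neg-distribʳ-* (P^ (ex x')) (⌊ x ⌋ m)) (ℤ.neg-distribʳ-* (P^ (ex x)) (⌊ x' ⌋ m))
      (mod-neg (≃-residues x≃x' m))

  ⊕-comm : ∀ x y → x ⊕ y ≃ y ⊕ x
  ⊕-comm x y = ≃-by-identity (P^ (ex y) * P^ (ex x)) (P^ (ex x) * P^ (ex y)) (P^-+ (ex y) (ex x)) (P^-+ (ex x) (ex y))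
    λ m → _ , _ , residue-⊕ x y m mod-refl mod-refl , residue-⊕ y x m mod-refl mod-refl ,
          lemma (P^ (ex x)) (P^ (ex y)) (⌊ x ⌋ m) (⌊ y ⌋ m)
    where
    lemma : ∀ a b u v → b * a * (b * u + a * v) ≡ a * b * (a * v + b * u)
    lemma = solve-∀

  ⊕-assoc : ∀ x y z → (x ⊕ y) ⊕ z ≃ x ⊕ (y ⊕ z)
  ⊕-assoc x y z = ≃-by-identity (a * (b * c)) ((a * b) * c)
    (trans (P^-+ (ex x) (ex y ℕ.+ ex z)) (cong (a *_) (P^-+ (ex y) (ex z))))
    (trans (P^-+ (ex x ℕ.+ ex y) (ex z)) (cong (_* c) (P^-+ (ex x) (ex y))))
    λ m → _ , _ ,
      subst (Residue m _) (cong (λ t → c * (b * ⌊ x ⌋ m + a * ⌊ y ⌋ m) + t * ⌊ z ⌋ m) (P^-+ (ex x) (ex y)))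
        (residue-⊕ (x ⊕ y) z m (residue-⊕ x y m mod-refl mod-refl) mod-refl) ,
      subst (Residue m _) (cong (λ t → t * ⌊ x ⌋ m + a * (c * ⌊ y ⌋ m + b * ⌊ z ⌋ m)) (P^-+ (ex y) (ex z)))
        (residue-⊕ x (y ⊕ z) m mod-refl (residue-⊕ y z m mod-refl mod-refl)) ,
      lemma a b c (⌊ x ⌋ m) (⌊ y ⌋ m) (⌊ z ⌋ m)
    where
    a = P^ (ex x) ; b = P^ (ex y) ; c = P^ (ex z)
    lemma : ∀ a b c u v w → a * (b * c) * (c * (b * u + a * v) + a * b * w)
                          ≡ a * b * c * (b * c * u + a * (c * v + b * w))
    lemma = solve-∀

  ⊕-identityˡ : ∀ x → 0q ⊕ x ≃ x
  ⊕-identityˡ x = ≃-by-identity (P^ (ex x)) (P^ (ex x)) refl refl λ m →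
    _ , _ , residue-⊕ 0q x m (residue-ℕ 0 m) mod-refl , mod-refl , lemma (P^ (ex x)) (⌊ x ⌋ m)
    where
    lemma : ∀ a u → a * (a * + 0 + + 1 * u) ≡ a * u
    lemma = solve-∀

  ⊕-inverseˡ : ∀ x → (⊖ x) ⊕ x ≃ 0q
  ⊕-inverseˡ x = ≃-by-identity (+ 1) (P^ (ex x ℕ.+ ex x)) refl refl λ m →
    _ , _ , residue-⊕ (⊖ x) x m (residue-neg m mod-refl) mod-refl , residue-ℕ 0 m ,
    lemma (P^ (ex x)) (P^ (ex x ℕ.+ ex x)) (⌊ x ⌋ m)
    where
    lemma : ∀ a b u → + 1 * (a * - u + a * u) ≡ b * + 0
    lemma = solve-∀

  ⊗-comm : ∀ x y → x ⊗ y ≃ y ⊗ x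
  ⊗-comm x y = ≃-by-identity (P^ (ex y) * P^ (ex x)) (P^ (ex x) * P^ (ex y)) (P^-+ (ex y) (ex x)) (P^-+ (ex x) (ex y))
    λ m → _ , _ , residue-* m mod-refl mod-refl , residue-* m mod-refl mod-refl ,
          lemma (P^ (ex x)) (P^ (ex y)) (⌊ x ⌋ m) (⌊ y ⌋ m)
    where
    lemma : ∀ a b u v → b * a * (u * v) ≡ a * b * (v * u)
    lemma = solve-∀

  ⊗-assoc : ∀ x y z → (x ⊗ y) ⊗ z ≃ x ⊗ (y ⊗ z)
  ⊗-assoc x y z = ≃-by-identity (P^ (ex x ℕ.+ (ex y ℕ.+ ex z))) (P^ ((ex x ℕ.+ ex y) ℕ.+ ex z)) refl refl λ m →
    _ , _ , residue-* m (residue-* m mod-refl mod-refl) mod-refl ,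
    residue-* m mod-refl (residue-* m mod-refl mod-refl) ,
    cong₂ _*_ (cong P^ (sym (ℕ.+-assoc (ex x) (ex y) (ex z)))) (ℤ.*-assoc (⌊ x ⌋ m) (⌊ y ⌋ m) (⌊ z ⌋ m))

  ⊗-identityˡ : ∀ x → 1q ⊗ x ≃ x
  ⊗-identityˡ x = ≃-by-identity (P^ (ex x)) (P^ (ex x)) refl refl λ m →
    _ , _ , residue-* m (residue-ℕ 1 m) mod-refl , mod-refl ,
    cong (P^ (ex x) *_) (ℤ.*-identityˡ (⌊ x ⌋ m))

  ⊗-distribˡ-⊕ : ∀ x y z → x ⊗ (y ⊕ z) ≃ (x ⊗ y) ⊕ (x ⊗ z)
  ⊗-distribˡ-⊕ x y z = ≃-by-identity (a * b * (a * c)) (a * (b * c))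
    (trans (P^-+ (ex x ℕ.+ ex y) (ex x ℕ.+ ex z)) (cong₂ _*_ (P^-+ (ex x) (ex y)) (P^-+ (ex x) (ex z))))
    (trans (P^-+ (ex x) (ex y ℕ.+ ex z)) (cong (a *_) (P^-+ (ex y) (ex z))))
    λ m → _ , _ , residue-* m mod-refl (residue-⊕ y z m mod-refl mod-refl) ,
      subst (Residue m _) (cong₂ (λ s t → s * (⌊ x ⌋ m * ⌊ y ⌋ m) + t * (⌊ x ⌋ m * ⌊ z ⌋ m))
                                 (P^-+ (ex x) (ex z)) (P^-+ (ex x) (ex y)))
        (residue-⊕ (x ⊗ y) (x ⊗ z) m (residue-* m mod-refl mod-refl) (residue-* m mod-refl mod-refl)) ,
      lemma a b c (⌊ x ⌋ m) (⌊ y ⌋ m) (⌊ z ⌋ m)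
    where
    a = P^ (ex x) ; b = P^ (ex y) ; c = P^ (ex z)
    lemma : ∀ a b c t u v → a * b * (a * c) * (t * (c * u + b * v))
                          ≡ a * (b * c) * (a * c * (t * u) + a * b * (t * v))
    lemma = solve-∀

  ≃-setoid : Setoid 0ℓ 0ℓ
  ≃-setoid = record
    { Carrier       = Qp
    ; _≈_           = _≃_
    ; isEquivalence = record { refl = ≃-refl ; sym = ≃-sym ; trans = ≃-trans }
    }

  ℚₚ : CommutativeRing 0ℓ 0ℓ
  ℚₚ = record
    { Carrier           = Qp
    ; _≈_               = _≃_
    ; _+_               = _⊕_
    ; _*_               = _⊗_
    ; -_                = ⊖_
    ; 0#                = 0q
    ; 1#                = 1q
    ; isCommutativeRing = record
      { isRing = record
        { +-isAbelianGroup = record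
          { isGroup = record
            { isMonoid = record
              { isSemigroup = record
                { isMagma = record { isEquivalence = Setoid.isEquivalence ≃-setoid ; ∙-cong = ⊕-cong }
                ; assoc   = ⊕-assoc
                }
              ; identity = comm∧idˡ⇒id ⊕-comm ⊕-identityˡ
              }
            ; inverse = comm∧invˡ⇒inv ⊕-comm ⊕-inverseˡ
            ; ⁻¹-cong = ⊖-cong
            }
          ; comm = ⊕-comm
          }
        ; *-cong     = ⊗-cong
        ; *-assoc    = ⊗-assoc
        ; *-identity = comm∧idˡ⇒id ⊗-comm ⊗-identityˡ
        ; distrib    = comm∧distrˡ⇒distr ⊕-cong ⊗-comm ⊗-distribˡ-⊕
        }
      ; *-comm = ⊗-comm
      }
    }
    where open Consequences ≃-setoid

  ι-⊕ : ∀ a b → ι a ⊕ ι b ≃ ι (a +ᶻ b)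
  ι-⊕ a b = ≃-by-identity (+ 1) (+ 1) refl refl λ m →
    _ , _ , residue-⊕ (ι a) (ι b) m mod-refl mod-refl , residue-+ m mod-refl mod-refl ,
    lemma (+ trunc a m) (+ trunc b m)
    where
    lemma : ∀ u v → + 1 * (+ 1 * u + + 1 * v) ≡ + 1 * (u + v)
    lemma = solve-∀

  p⁻¹ : Qp
  p⁻¹ = ℕ→Zp 1 /p^ 1

  p⁻¹⊗p : p⁻¹ ⊗ pq ≃ 1q
  p⁻¹⊗p = ≃-by-identity (+ 1) (+ p) refl (cong +_ (ℕ.*-identityʳ p)) λ m →
    _ , _ , residue-* m (residue-ℕ 1 m) (residue-ℕ p m) , residue-ℕ 1 m , lemma (+ p)
    where
    lemma : ∀ q → + 1 * (+ 1 * q) ≡ q * + 1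
    lemma = solve-∀

  open CommutativeRing ℚₚ
    using (ring; *-commutativeSemigroup; distribˡ; zeroʳ; *-identityʳ; *-identityˡ; +-identityʳ; +-identityˡ)
  open RingProperties ring using (-‿distribʳ-*)
  open CommutativeSemigroupProperties *-commutativeSemigroup using (interchange)

  -- Fractional ideals c ℤ_p

  infix 4 _∈_·ℤₚ
  _∈_·ℤₚ : Qp → Qp → Set
  x ∈ c ·ℤₚ = Σ Zp λ b → x ≃ c ⊗ ι b

  ∈-resp : ∀ {c x y} → x ≃ y → x ∈ c ·ℤₚ → y ∈ c ·ℤₚ
  ∈-resp x≃y (b , x≃cb) = b , ≃-trans (≃-sym x≃y) x≃cb

  ∈-rescale : ∀ {c d x} → c ≃ d → x ∈ c ·ℤₚ → x ∈ d ·ℤₚ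
  ∈-rescale c≃d (b , x≃cb) = b , ≃-trans x≃cb (⊗-cong c≃d ≃-refl)

  ∈-self : ∀ c → c ∈ c ·ℤₚ
  ∈-self c = ℕ→Zp 1 , ≃-sym (*-identityʳ c)

  ∈-0 : ∀ {c} → 0q ∈ c ·ℤₚ
  ∈-0 {c} = ℕ→Zp 0 , ≃-sym (zeroʳ c)

  ∈-⊕ : ∀ {c x y} → x ∈ c ·ℤₚ → y ∈ c ·ℤₚ → x ⊕ y ∈ c ·ℤₚ
  ∈-⊕ {c} {x} {y} (a , x≃ca) (b , y≃cb) = a +ᶻ b , (begin
    x ⊕ y                  ≈⟨ ⊕-cong x≃ca y≃cb ⟩
    (c ⊗ ι a) ⊕ (c ⊗ ι b)  ≈⟨ distribˡ c (ι a) (ι b) ⟨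
    c ⊗ (ι a ⊕ ι b)        ≈⟨ ⊗-cong ≃-refl (ι-⊕ a b) ⟩
    c ⊗ ι (a +ᶻ b)         ∎)
    where open SetoidReasoning ≃-setoid

  ∈-⊖ : ∀ {c x} → x ∈ c ·ℤₚ → ⊖ x ∈ c ·ℤₚ
  ∈-⊖ {c} (a , x≃ca) = -ᶻ a , ≃-trans (⊖-cong x≃ca) (-‿distribʳ-* c (ι a))

  ∈-⊟ : ∀ {c x y} → x ∈ c ·ℤₚ → y ∈ c ·ℤₚ → x ⊟ y ∈ c ·ℤₚ
  ∈-⊟ x∈ y∈ = ∈-⊕ x∈ (∈-⊖ y∈)

  ∈-⊗ : ∀ {c d x y} → x ∈ c ·ℤₚ → y ∈ d ·ℤₚ → x ⊗ y ∈ c ⊗ d ·ℤₚ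
  ∈-⊗ {c} {d} (a , x≃ca) (b , y≃db) = a *ᶻ b , ≃-trans (⊗-cong x≃ca y≃db) (interchange c (ι a) d (ι b))

  ∈-⊗ˡ : ∀ {c x y} → x ∈ c ·ℤₚ → y ∈ 1q ·ℤₚ → x ⊗ y ∈ c ·ℤₚ
  ∈-⊗ˡ {c} x∈ y∈ = ∈-rescale (*-identityʳ c) (∈-⊗ x∈ y∈)

  ∈-⊗ʳ : ∀ {c x y} → x ∈ 1q ·ℤₚ → y ∈ c ·ℤₚ → x ⊗ y ∈ c ·ℤₚ
  ∈-⊗ʳ {c} x∈ y∈ = ∈-rescale (*-identityˡ c) (∈-⊗ x∈ y∈)

  ∈-widen : ∀ {c d x} → c ∈ d ·ℤₚ → x ∈ c ·ℤₚ → x ∈ d ·ℤₚ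
  ∈-widen {c} {d} (e , c≃de) (a , x≃ca) =
    e *ᶻ a , ≃-trans x≃ca (≃-trans (⊗-cong c≃de ≃-refl) (⊗-assoc d (ι e) (ι a)))

  ∈ℤₚ⇒InZp : ∀ {x} → x ∈ 1q ·ℤₚ → InZp x
  ∈ℤₚ⇒InZp (b , x≃b) = b , ≈-of (≃-trans x≃b (⊗-identityˡ (ι b)))

  InZp⇒∈ℤₚ : ∀ {x} → InZp x → x ∈ 1q ·ℤₚ
  InZp⇒∈ℤₚ (b , x≈b) = b , ≃-trans (mk≃ x≈b) (≃-sym (⊗-identityˡ (ι b)))

  ι∈ℤₚ : ∀ b → ι b ∈ 1q ·ℤₚ
  ι∈ℤₚ b = b , ≃-sym (⊗-identityˡ (ι b))

  p∈ℤₚ : pq ∈ 1q ·ℤₚ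
  p∈ℤₚ = ι∈ℤₚ (ℕ→Zp p)

  1∈p⁻¹ℤₚ : 1q ∈ p⁻¹ ·ℤₚ
  1∈p⁻¹ℤₚ = ℕ→Zp p , ≃-sym p⁻¹⊗p

  1∉pℤₚ : 1 ℕ.< p → ¬ 1q ∈ pq ·ℤₚ
  1∉pℤₚ 1<p (b , 1≃pb) = contradiction (mod-injective 1<p' (ℕ.<-trans (ℕ.s≤s ℕ.z≤n) 1<p') 1≡0) λ ()
    where
    1<p' : 1 ℕ.< p ℕ.^ 1
    1<p' = subst (1 ℕ.<_) (sym (ℕ.*-identityʳ p)) 1<p
    open SetoidReasoning (mod-setoid (p ℕ.^ 1))
    1≡0 : + 1 ≡ + 0 mod p ℕ.^ 1
    1≡0 = begin
      + 1                                ≈⟨ residue-ℕ 1 1 ⟨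
      + trunc (ℕ→Zp 1) 1                 ≡⟨ ℤ.*-identityˡ _ ⟨
      + 1 * + trunc (ℕ→Zp 1) 1           ≈⟨ ≃-residues 1≃pb 1 ⟩
      + 1 * ⌊ pq ⊗ ι b ⌋ 1               ≈⟨ mod-* (mod-refl {x = + 1}) (residue-* {ℕ→Zp p} {b} 1 (residue-ℕ p 1) mod-refl) ⟩
      + 1 * (+ p * + trunc b 1)          ≡⟨ cong (λ t → + 1 * (t * + trunc b 1)) (cong +_ (ℕ.*-identityʳ p)) ⟨
      + 1 * (+ (p ℕ.^ 1) * + trunc b 1)  ≡⟨ lemma (+ trunc b 1) (+ (p ℕ.^ 1)) ⟩
      + trunc b 1 * + (p ℕ.^ 1)          ≈⟨ multiple≡0 (+ trunc b 1) ⟩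
      + 0                                ∎
      where
      lemma : ∀ t q → + 1 * (q * t) ≡ t * q
      lemma = solve-∀

  p⁻¹∉ℤₚ : 1 ℕ.< p → ¬ p⁻¹ ∈ 1q ·ℤₚ
  p⁻¹∉ℤₚ 1<p (b , p⁻¹≃b) = 1∉pℤₚ 1<p (b , (begin
    1q                ≈⟨ p⁻¹⊗p ⟨
    p⁻¹ ⊗ pq          ≈⟨ ⊗-cong p⁻¹≃b ≃-refl ⟩
    (1q ⊗ ι b) ⊗ pq   ≈⟨ ⊗-cong (⊗-identityˡ (ι b)) ≃-refl ⟩
    ι b ⊗ pq          ≈⟨ ⊗-comm (ι b) pq ⟩
    pq ⊗ ι b          ∎))
    where open SetoidReasoning ≃-setoid

  pℤₚ⊆ℤₚ : ∀ {x} → x ∈ pq ·ℤₚ → x ∈ 1q ·ℤₚ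
  pℤₚ⊆ℤₚ = ∈-widen p∈ℤₚ

  ℤₚ⊆p⁻¹ℤₚ : ∀ {x} → x ∈ 1q ·ℤₚ → x ∈ p⁻¹ ·ℤₚ
  ℤₚ⊆p⁻¹ℤₚ = ∈-widen 1∈p⁻¹ℤₚ

  InPZp⇒∈pℤₚ : ∀ {x} → InPZp x → x ∈ pq ·ℤₚ
  InPZp⇒∈pℤₚ (b , x≈pb) = b , mk≃ x≈pb

  ∈pℤₚ⇒InPZp : ∀ {x} → x ∈ pq ·ℤₚ → InPZp x
  ∈pℤₚ⇒InPZp (b , x≃pb) = b , ≈-of x≃pb

  1⊗1 : 1q ⊗ 1q ≃ 1q
  1⊗1 = *-identityʳ 1q

  p⊗p⁻¹∈ℤₚ : pq ⊗ p⁻¹ ∈ 1q ·ℤₚ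
  p⊗p⁻¹∈ℤₚ = ∈-resp (≃-sym (≃-trans (⊗-comm pq p⁻¹) p⁻¹⊗p)) (∈-self 1q)

  p⊗1∈pℤₚ : pq ⊗ 1q ∈ pq ·ℤₚ
  p⊗1∈pℤₚ = ∈-resp (≃-sym (*-identityʳ pq)) (∈-self pq)

  ∈-divide : ∀ {c d x} → x ⊗ c ∈ 1q ·ℤₚ → d ⊗ c ≃ 1q → x ∈ d ·ℤₚ
  ∈-divide {c} {d} {x} xc∈ dc≃1 = ∈-resp x≃ (∈-rescale (⊗-identityˡ d) (∈-⊗ xc∈ (∈-self d)))
    where
    open SetoidReasoning ≃-setoid
    x≃ : (x ⊗ c) ⊗ d ≃ x
    x≃ = begin
      (x ⊗ c) ⊗ d  ≈⟨ ⊗-assoc x c d ⟩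
      x ⊗ (c ⊗ d)  ≈⟨ ⊗-cong ≃-refl (≃-trans (⊗-comm c d) dc≃1) ⟩
      x ⊗ 1q       ≈⟨ *-identityʳ x ⟩
      x            ∎

  -- Coordinates, finite sums and the trace form

  δ : ∀ {n} → Fin n → Fin n → Qp
  δ zero    zero    = 1q
  δ zero    (suc j) = 0q
  δ (suc i) zero    = 0q
  δ (suc i) (suc j) = δ i j

  δ-sym : ∀ {n} (i j : Fin n) → δ i j ≡ δ j i
  δ-sym zero    zero    = refl
  δ-sym zero    (suc j) = refl
  δ-sym (suc i) zero    = refl
  δ-sym (suc i) (suc j) = δ-sym i j

  ∈-⊗-δ : ∀ {n} (g : Fin n → Qp) i j → g i ⊗ δ i j ∈ g j ·ℤₚ
  ∈-⊗-δ g zero    zero    = ∈-resp (≃-sym (*-identityʳ (g 0F))) (∈-self (g 0F))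
  ∈-⊗-δ g zero    (suc j) = ∈-resp (≃-sym (zeroʳ (g 0F))) ∈-0
  ∈-⊗-δ g (suc i) zero    = ∈-resp (≃-sym (zeroʳ (g (suc i)))) ∈-0
  ∈-⊗-δ g (suc i) (suc j) = ∈-⊗-δ (λ k → g (suc k)) i j

  -- Opaque, so that Agda never unfolds a concrete sum (and with it the digit arithmetic of Defs)
  -- while comparing two of them.
  opaque
    ∑ : ∀ {n} → (Fin n → Qp) → Qp
    ∑ {zero}  f = 0q
    ∑ {suc n} f = f 0F ⊕ ∑ (λ k → f (suc k))

  opaque
    unfolding ∑

    ∑-zero : (f : Fin 0 → Qp) → ∑ f ≡ 0q
    ∑-zero f = refl

    ∑-suc : ∀ {n} (f : Fin (suc n) → Qp) → ∑ f ≡ f 0F ⊕ ∑ (λ k → f (suc k))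
    ∑-suc f = refl

    ∑-cong : ∀ {n} {f g : Fin n → Qp} → (∀ k → f k ≃ g k) → ∑ f ≃ ∑ g
    ∑-cong {zero}  f≃g = ≃-refl
    ∑-cong {suc n} f≃g = ⊕-cong (f≃g 0F) (∑-cong (λ k → f≃g (suc k)))

    ∈-∑ : ∀ {n c} (f : Fin n → Qp) → (∀ i → f i ∈ c ·ℤₚ) → ∑ f ∈ c ·ℤₚ
    ∈-∑ {zero}  f f∈ = ∈-0
    ∈-∑ {suc n} f f∈ = ∈-⊕ (f∈ 0F) (∈-∑ (λ i → f (suc i)) (λ i → f∈ (suc i)))

    ∑-⊗-δ : ∀ {n} (f : Fin n → Qp) i → ∑ (λ k → f k ⊗ δ k i) ≃ f i
    ∑-⊗-δ f zero = ≃-trans (⊕-cong (*-identityʳ (f 0F)) (∑-⊗-0 (λ k → f (suc k))))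
                            (+-identityʳ (f 0F))
      where
      ∑-⊗-0 : ∀ {n} (g : Fin n → Qp) → ∑ (λ k → g k ⊗ 0q) ≃ 0q
      ∑-⊗-0 {zero}  g = ≃-refl
      ∑-⊗-0 {suc n} g = ≃-trans (⊕-cong (zeroʳ (g 0F)) (∑-⊗-0 (λ k → g (suc k)))) (+-identityʳ 0q)
    ∑-⊗-δ f (suc i) = ≃-trans (⊕-cong (zeroʳ (f 0F)) (∑-⊗-δ (λ k → f (suc k)) i)) (+-identityˡ (f (suc i)))

  -- Unfolded one step at a time: proving this by refl makes Agda compare both sides digit by digit.
  ∑₈ : ∀ (f : Fin 8 → Qp) → ∑ f ≡ f 0F ⊕ (f 1F ⊕ (f 2F ⊕ (f 3F ⊕ (f 4F ⊕ (f 5F ⊕ (f 6F ⊕ (f 7F ⊕ 0q)))))))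
  ∑₈ f =
    trans (∑-suc f) (cong (f 0F ⊕_) (
    trans (∑-suc _) (cong (f 1F ⊕_) (
    trans (∑-suc _) (cong (f 2F ⊕_) (
    trans (∑-suc _) (cong (f 3F ⊕_) (
    trans (∑-suc _) (cong (f 4F ⊕_) (
    trans (∑-suc _) (cong (f 5F ⊕_) (
    trans (∑-suc _) (cong (f 6F ⊕_) (
    trans (∑-suc _) (cong (f 7F ⊕_) (
    ∑-zero _))))))))))))))))

  coord : Fin 8 → 𝕆 → Qp
  coord 0F x = 𝕆.a x
  coord 1F x = V3.c₁ (𝕆.v x)
  coord 2F x = V3.c₂ (𝕆.v x)
  coord 3F x = V3.c₃ (𝕆.v x)
  coord 4F x = V3.c₁ (𝕆.w x)
  coord 5F x = V3.c₂ (𝕆.w x)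
  coord 6F x = V3.c₃ (𝕆.w x)
  coord 7F x = 𝕆.d x

  octonion : (Fin 8 → Qp) → 𝕆
  octonion f = [ f 0F , ⟨ f 1F , f 2F , f 3F ⟩ , ⟨ f 4F , f 5F , f 6F ⟩ , f 7F ]

  coord-octonion : ∀ i f → coord i (octonion f) ≡ f i
  coord-octonion 0F f = refl
  coord-octonion 1F f = refl
  coord-octonion 2F f = refl
  coord-octonion 3F f = refl
  coord-octonion 4F f = refl
  coord-octonion 5F f = refl
  coord-octonion 6F f = refl
  coord-octonion 7F f = refl

  -- +ₒ, ·ₒ and 0ₒ are octonions of coordinatewise values up to η, so coord-octonion applies.
  coord-+ₒ : ∀ i x y → coord i (x +ₒ y) ≡ coord i x ⊕ coord i y
  coord-+ₒ i x y = coord-octonion i (λ j → coord j x ⊕ coord j y)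

  coord-·ₒ : ∀ i c x → coord i (c ·ₒ x) ≡ c ⊗ coord i x
  coord-·ₒ i c x = coord-octonion i (λ j → c ⊗ coord j x)

  coord-0ₒ : ∀ i → coord i 0ₒ ≡ 0q
  coord-0ₒ i = coord-octonion i (λ _ → 0q)

  infix 4 _≃ₒ_
  _≃ₒ_ : 𝕆 → 𝕆 → Set
  x ≃ₒ y = ∀ i → coord i x ≃ coord i y

  ≃ₒ-sym : ∀ {x y} → x ≃ₒ y → y ≃ₒ x
  ≃ₒ-sym x≃y i = ≃-sym (x≃y i)

  ≈ₒ⇒≃ₒ : ∀ x y → x ≈ₒ y → x ≃ₒ y
  ≈ₒ⇒≃ₒ x y (e₀ , (e₁ , e₂ , e₃) , (e₄ , e₅ , e₆) , e₇) = λ where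
    0F → mk≃ e₀
    1F → mk≃ e₁
    2F → mk≃ e₂
    3F → mk≃ e₃
    4F → mk≃ e₄
    5F → mk≃ e₅
    6F → mk≃ e₆
    7F → mk≃ e₇

  ≃ₒ⇒≈ₒ : ∀ {x y} → x ≃ₒ y → x ≈ₒ y
  ≃ₒ⇒≈ₒ e = ≈-of (e 0F) , (≈-of (e 1F) , ≈-of (e 2F) , ≈-of (e 3F)) ,
            (≈-of (e 4F) , ≈-of (e 5F) , ≈-of (e 6F)) , ≈-of (e 7F)

  opaque
    unfolding ∑

    coord-lincomb : ∀ {n} i (cs : Vec Qp n) (g : Fin n → 𝕆) →
                    coord i (lincomb cs (tabulate g)) ≡ ∑ (λ k → lookup cs k ⊗ coord i (g k))
    coord-lincomb i []       g = coord-0ₒ i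
    coord-lincomb i (c ∷ cs) g = trans (coord-+ₒ i (c ·ₒ g 0F) (lincomb cs (tabulate (λ k → g (suc k)))))
                                       (cong₂ _⊕_ (coord-·ₒ i c (g 0F)) (coord-lincomb i cs (λ k → g (suc k))))

  lookup-Zpmap : ∀ {n} (cs : Vec Zp n) k → lookup (Zpmap cs) k ≡ ι (lookup cs k)
  lookup-Zpmap (c ∷ cs) zero    = refl
  lookup-Zpmap (c ∷ cs) (suc k) = lookup-Zpmap cs k

  σ : Fin 8 → Fin 8
  σ 0F = 0F
  σ 1F = 4F
  σ 2F = 5F
  σ 3F = 6F
  σ 4F = 1F
  σ 5F = 2F
  σ 6F = 3F
  σ 7F = 7F

  σ-involutive : ∀ j → σ (σ j) ≡ j
  σ-involutive 0F = refl
  σ-involutive 1F = refl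
  σ-involutive 2F = refl
  σ-involutive 3F = refl
  σ-involutive 4F = refl
  σ-involutive 5F = refl
  σ-involutive 6F = refl
  σ-involutive 7F = refl

  -- Stated for raw operations so that instantiating it at ℚ_p is purely syntactic: running the solver at
  -- ℚ_p itself would make Agda unfold the digit-level arithmetic of Defs.
  module _ {a ℓ} {A : Set a} {_≈_ : Rel A ℓ} {_∙_ : Op₂ A} {ε : A} (isCM : IsCommutativeMonoid _≈_ _∙_ ε) where
    private
      M : CommutativeMonoid a ℓ
      M = record { isCommutativeMonoid = isCM }
    open import Algebra.Solver.CommutativeMonoid M using (solve; _⊜_; id) renaming (_⊕_ to _⊞_)
    open IsCommutativeMonoid isCM using () renaming (refl to ≈-refl)

    trace-rearrange : ∀ a b c d e f g h → ((a ∙ ((b ∙ c) ∙ d)) ∙ (h ∙ ((e ∙ f) ∙ g)))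
                                        ≈ (a ∙ (e ∙ (f ∙ (g ∙ (b ∙ (c ∙ (d ∙ (h ∙ ε))))))))
    trace-rearrange = solve 8 (λ a b c d e f g h → (a ⊞ ((b ⊞ c) ⊞ d)) ⊞ (h ⊞ ((e ⊞ f) ⊞ g))
                                                 ⊜ a ⊞ (e ⊞ (f ⊞ (g ⊞ (b ⊞ (c ⊞ (d ⊞ (h ⊞ id))))))))
                            ≈-refl

  ⊕-isCommutativeMonoid : IsCommutativeMonoid _≃_ _⊕_ 0q
  ⊕-isCommutativeMonoid = CommutativeRing.+-isCommutativeMonoid ℚₚ

  T-*ₒ : ∀ x y → T (x *ₒ y) ≃ ∑ (λ j → coord (σ j) x ⊗ coord j y)
  T-*ₒ x y = ≃-trans (trace-rearrange ⊕-isCommutativeMonoid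
                        (t 0F) (t 4F) (t 5F) (t 6F) (t 1F) (t 2F) (t 3F) (t 7F))
                     (≃-reflexive (sym (∑₈ t)))
    where
    t : Fin 8 → Qp
    t j = coord (σ j) x ⊗ coord j y

  -- Boxes and their duals

  Box : 𝕆 → Subset
  Box s x = ∀ i → coord i x ∈ coord i s ·ℤₚ

  Box-resp : ∀ {s x y} → x ≃ₒ y → Box s x → Box s y
  Box-resp x≃y x∈ i = ∈-resp (x≃y i) (x∈ i)

  Box-0 : ∀ {s} → Box s 0ₒ
  Box-0 {s} i = subst (_∈ coord i s ·ℤₚ) (sym (coord-0ₒ i)) ∈-0

  Box-+ : ∀ {s x y} → Box s x → Box s y → Box s (x +ₒ y)
  Box-+ {s} {x} {y} x∈ y∈ i = subst (_∈ coord i s ·ℤₚ) (sym (coord-+ₒ i x y)) (∈-⊕ (x∈ i) (y∈ i))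

  Box-scale : ∀ {s c d x} → c ∈ d ·ℤₚ → Box s x → Box (d ·ₒ s) (c ·ₒ x)
  Box-scale {s} {c} {d} {x} c∈ x∈ i =
    subst₂ _∈_·ℤₚ (sym (coord-·ₒ i c x)) (sym (coord-·ₒ i d s)) (∈-⊗ c∈ (x∈ i))

  Box-·ₒ : ∀ {s c x} → c ∈ 1q ·ℤₚ → Box s x → Box s (c ·ₒ x)
  Box-·ₒ {s} {c} {x} c∈ x∈ i = subst (_∈ coord i s ·ℤₚ) (sym (coord-·ₒ i c x)) (∈-⊗ʳ c∈ (x∈ i))

  Box-widen : ∀ {s t} → (∀ i → coord i s ∈ coord i t ·ℤₚ) → Box s ⊆ Box t
  Box-widen s⊆t x x∈ i = ∈-widen (s⊆t i) (x∈ i)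

  Box-isSubmodule : ∀ s → IsSubmodule (Box s)
  Box-isSubmodule s =
    (λ x y x≈y → Box-resp (≈ₒ⇒≃ₒ x y x≈y)) , Box-0 , (λ x y → Box-+) , (λ c x → Box-·ₒ (ι∈ℤₚ c))

  Box-lincomb : ∀ {s n} (cs : Vec Zp n) {gs} → All (Box s) gs → Box s (lincomb (Zpmap cs) gs)
  Box-lincomb []       []           = Box-0
  Box-lincomb (c ∷ cs) (g∈ ∷ gs∈) = Box-+ (Box-·ₒ (ι∈ℤₚ c) g∈) (Box-lincomb cs gs∈)

  basisCoord : 𝕆 → Fin 8 → Fin 8 → Qp
  basisCoord s k j = coord k s ⊗ δ k j

  basisVector : 𝕆 → Fin 8 → 𝕆
  basisVector s k = octonion (basisCoord s k)

  basisVector∈Box : ∀ s k → Box s (basisVector s k)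
  basisVector∈Box s k j =
    subst (_∈ coord j s ·ℤₚ) (sym (coord-octonion j (basisCoord s k))) (∈-⊗-δ (λ i → coord i s) k j)


  coord-lincomb-basis : ∀ s cs i → coord i (lincomb cs (tabulate (basisVector s))) ≃ lookup cs i ⊗ coord i s
  coord-lincomb-basis s cs i = begin
    coord i (lincomb cs (tabulate (basisVector s)))        ≡⟨ coord-lincomb i cs (basisVector s) ⟩
    ∑ (λ k → lookup cs k ⊗ coord i (basisVector s k))     ≈⟨ ∑-cong reassociate ⟩
    ∑ (λ k → term k ⊗ δ k i)                               ≈⟨ ∑-⊗-δ term i ⟩
    term i                                                 ∎
    where
    open SetoidReasoning ≃-setoid
    term : Fin 8 → Qp
    term k = lookup cs k ⊗ coord k s
    reassociate : ∀ k → lookup cs k ⊗ coord i (basisVector s k) ≃ term k ⊗ δ k i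
    reassociate k = ≃-trans (≃-reflexive (cong (lookup cs k ⊗_) (coord-octonion i (basisCoord s k))))
                            (≃-sym (⊗-assoc (lookup cs k) (coord k s) (δ k i)))

  Box-isLattice : ∀ s → (∀ i → ∃ λ u → u ⊗ coord i s ≃ 1q) → IsLattice (Box s)
  Box-isLattice s invertible =
    Box-isSubmodule s , 8 , tabulate (basisVector s) , tabulate⁺ (basisVector∈Box s) , ℤₚ-span , ℚₚ-span
    where
    open SetoidReasoning ≃-setoid
    ℤₚ-span : ∀ x → Box s x → Σ (Vec Zp 8) λ bs → x ≈ₒ lincomb (Zpmap bs) (tabulate (basisVector s))
    ℤₚ-span x x∈ = bs , ≃ₒ⇒≈ₒ λ i → begin
      coord i x                                                ≈⟨ proj₂ (x∈ i) ⟩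
      coord i s ⊗ ι (proj₁ (x∈ i))                             ≈⟨ ⊗-comm (coord i s) (ι (proj₁ (x∈ i))) ⟩
      ι (proj₁ (x∈ i)) ⊗ coord i s                             ≡⟨ cong (λ b → ι b ⊗ coord i s) (Vec.lookup∘tabulate (λ i → proj₁ (x∈ i)) i) ⟨
      ι (lookup bs i) ⊗ coord i s                              ≡⟨ cong (_⊗ coord i s) (lookup-Zpmap bs i) ⟨
      lookup (Zpmap bs) i ⊗ coord i s                          ≈⟨ coord-lincomb-basis s (Zpmap bs) i ⟨
      coord i (lincomb (Zpmap bs) (tabulate (basisVector s)))  ∎
      where bs = tabulate λ i → proj₁ (x∈ i)
    ℚₚ-span : ∀ x → Σ (Vec Qp 8) λ cs → x ≈ₒ lincomb cs (tabulate (basisVector s))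
    ℚₚ-span x = cs , ≃ₒ⇒≈ₒ λ i → begin
      coord i x                                      ≈⟨ *-identityʳ (coord i x) ⟨
      coord i x ⊗ 1q                                 ≈⟨ ⊗-cong ≃-refl (proj₂ (invertible i)) ⟨
      coord i x ⊗ (proj₁ (invertible i) ⊗ coord i s) ≈⟨ ⊗-assoc (coord i x) (proj₁ (invertible i)) (coord i s) ⟨
      (coord i x ⊗ proj₁ (invertible i)) ⊗ coord i s ≡⟨ cong (_⊗ coord i s) (Vec.lookup∘tabulate (λ i → coord i x ⊗ proj₁ (invertible i)) i) ⟨
      lookup cs i ⊗ coord i s                        ≈⟨ coord-lincomb-basis s cs i ⟨
      coord i (lincomb cs (tabulate (basisVector s))) ∎
      where cs = tabulate λ i → coord i x ⊗ proj₁ (invertible i)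

  Box⊆Dual : ∀ {s t} → (∀ j → coord j t ⊗ coord (σ j) s ≃ 1q) → Box t ⊆ Dual (Box s)
  Box⊆Dual {s} {t} pairing x x∈ y y∈ = ∈ℤₚ⇒InZp (∈-resp (≃-sym (T-*ₒ x y))
    (∈-∑ _ λ j → ∈-rescale (pairing′ j) (∈-⊗ (x∈ (σ j)) (y∈ j))))
    where
    pairing′ : ∀ j → coord (σ j) t ⊗ coord j s ≃ 1q
    pairing′ j = subst (λ k → coord (σ j) t ⊗ coord k s ≃ 1q) (σ-involutive j) (pairing (σ j))

  Dual⊆Box : ∀ {s t} → (∀ j → coord j t ⊗ coord (σ j) s ≃ 1q) → Dual (Box s) ⊆ Box t
  Dual⊆Box {s} {t} pairing x x∈ j =
    ∈-divide (∈-resp pick-out (InZp⇒∈ℤₚ (x∈ test (basisVector∈Box s (σ j))))) (pairing j)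
    where
    open SetoidReasoning ≃-setoid
    test = basisVector s (σ j)
    term : Fin 8 → Qp
    term k = coord (σ k) x ⊗ coord (σ j) s
    pick-out : T (x *ₒ test) ≃ coord j x ⊗ coord (σ j) s
    pick-out = begin
      T (x *ₒ test)                                 ≈⟨ T-*ₒ x test ⟩
      ∑ (λ k → coord (σ k) x ⊗ coord k test)         ≈⟨ ∑-cong reassociate ⟩
      ∑ (λ k → term k ⊗ δ k (σ j))                   ≈⟨ ∑-⊗-δ term (σ j) ⟩
      term (σ j)                                     ≡⟨ cong (λ i → coord i x ⊗ coord (σ j) s) (σ-involutive j) ⟩
      coord j x ⊗ coord (σ j) s                      ∎
      where
      reassociate : ∀ k → coord (σ k) x ⊗ coord k test ≃ term k ⊗ δ k (σ j)
      reassociate k = begin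
        coord (σ k) x ⊗ coord k test                     ≡⟨ cong (coord (σ k) x ⊗_) (coord-octonion k (basisCoord s (σ j))) ⟩
        coord (σ k) x ⊗ (coord (σ j) s ⊗ δ (σ j) k)      ≡⟨ cong (λ e → coord (σ k) x ⊗ (coord (σ j) s ⊗ e)) (δ-sym (σ j) k) ⟩
        coord (σ k) x ⊗ (coord (σ j) s ⊗ δ k (σ j))      ≈⟨ ⊗-assoc (coord (σ k) x) (coord (σ j) s) (δ k (σ j)) ⟨
        term k ⊗ δ k (σ j)                               ∎

  Dual-antitone : ∀ {A B} → A ⊆ B → Dual B ⊆ Dual A
  Dual-antitone A⊆B x x∈ y y∈ = x∈ y (A⊆B y y∈)

  IsLattice-resp : ∀ {A B} → A ⊆ B → B ⊆ A → IsLattice A → IsLattice B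
  IsLattice-resp A⊆B B⊆A ((resp , 0∈ , +∈ , ·∈) , n , gs , gs∈ , ℤₚ-span , ℚₚ-span) =
    ( (λ x y x≈y y∈ → A⊆B y (resp x y x≈y (B⊆A x y∈)))
    , A⊆B 0ₒ 0∈
    , (λ x y x∈ y∈ → A⊆B (x +ₒ y) (+∈ x y (B⊆A x x∈) (B⊆A y y∈)))
    , (λ c x x∈ → A⊆B (ι c ·ₒ x) (·∈ c x (B⊆A x x∈))) )
    , n , gs , All.map (λ {g} → A⊆B g) gs∈ , (λ x x∈ → ℤₚ-span x (B⊆A x x∈)) , ℚₚ-span

  -- DualSq names its product function in a where clause; it is used here only through its equations.
  DualSq⊆Box : ∀ {Λ s} → (∀ {x y} → Dual Λ x → Dual Λ y → Box s (x *ₒ y)) → DualSq Λ ⊆ Box s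
  DualSq⊆Box {Λ} {s} mul z z∈ = from-products _ z∈ refl (λ _ _ _ _ → refl)
    where
    from-products : (prods : ∀ {n} → Vec 𝕆 n → Vec 𝕆 n → Vec 𝕆 n) →
      (Σ ℕ λ n → Σ (Vec 𝕆 n) λ xs → Σ (Vec 𝕆 n) λ ys → Σ (Vec Zp n) λ cs →
        All (Dual Λ) xs × All (Dual Λ) ys × (z ≈ₒ lincomb (Zpmap cs) (prods xs ys))) →
      prods [] [] ≡ [] →
      (∀ {n} x y (xs ys : Vec 𝕆 n) → prods (x ∷ xs) (y ∷ ys) ≡ (x *ₒ y) ∷ prods xs ys) →
      Box s z
    from-products prods (n , xs , ys , cs , xs∈ , ys∈ , z≈) prods-[] prods-∷ =
      Box-resp (≃ₒ-sym (≈ₒ⇒≃ₒ z (lincomb (Zpmap cs) (prods xs ys)) z≈))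
               (Box-lincomb cs (products xs∈ ys∈))
      where
      products : ∀ {n} {xs ys : Vec 𝕆 n} → All (Dual Λ) xs → All (Dual Λ) ys → All (Box s) (prods xs ys)
      products [] [] = subst (All (Box s)) (sym prods-[]) []
      products {xs = x ∷ xs} {y ∷ ys} (x∈ ∷ xs∈) (y∈ ∷ ys∈) =
        subst (All (Box s)) (sym (prods-∷ x y xs ys)) (mul {x} {y} x∈ y∈ ∷ products xs∈ ys∈)

  -- The lattice Λ₀

  Λ-scales Λ*-scales p⁻¹Λ-scales : 𝕆
  Λ-scales    = [ 1q  , ⟨ pq , 1q  , 1q  ⟩ , ⟨ 1q  , pq , 1q  ⟩ , 1q  ]
  Λ*-scales   = [ 1q  , ⟨ 1q , p⁻¹ , 1q  ⟩ , ⟨ p⁻¹ , 1q , 1q  ⟩ , 1q  ]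
  p⁻¹Λ-scales = [ p⁻¹ , ⟨ 1q , p⁻¹ , p⁻¹ ⟩ , ⟨ p⁻¹ , 1q , p⁻¹ ⟩ , p⁻¹ ]

  Box-Λ-*ₒ : ∀ {x y} → Box Λ-scales x → Box Λ-scales y → Box Λ-scales (x *ₒ y)
  Box-Λ-*ₒ x∈ y∈ 0F =
    ∈-⊕ (∈-⊗ˡ (x∈ 0F) (y∈ 0F))
        (∈-⊕ (∈-⊕ (∈-⊗ˡ (pℤₚ⊆ℤₚ (x∈ 1F)) (y∈ 4F)) (∈-⊗ˡ (x∈ 2F) (pℤₚ⊆ℤₚ (y∈ 5F)))) (∈-⊗ˡ (x∈ 3F) (y∈ 6F)))
  Box-Λ-*ₒ x∈ y∈ 1F =
    ∈-⊕ (∈-⊕ (∈-⊗ʳ (x∈ 0F) (y∈ 1F)) (∈-⊗ʳ (y∈ 7F) (x∈ 1F)))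
        (∈-⊖ (∈-⊟ (∈-⊗ˡ (x∈ 5F) (y∈ 6F)) (∈-⊗ʳ (x∈ 6F) (y∈ 5F))))
  Box-Λ-*ₒ x∈ y∈ 2F =
    ∈-⊕ (∈-⊕ (∈-⊗ˡ (x∈ 0F) (y∈ 2F)) (∈-⊗ˡ (y∈ 7F) (x∈ 2F)))
        (∈-⊖ (∈-⊟ (∈-⊗ˡ (x∈ 6F) (y∈ 4F)) (∈-⊗ˡ (x∈ 4F) (y∈ 6F))))
  Box-Λ-*ₒ x∈ y∈ 3F =
    ∈-⊕ (∈-⊕ (∈-⊗ˡ (x∈ 0F) (y∈ 3F)) (∈-⊗ˡ (y∈ 7F) (x∈ 3F)))
        (∈-⊖ (∈-⊟ (∈-⊗ˡ (x∈ 4F) (pℤₚ⊆ℤₚ (y∈ 5F))) (∈-⊗ˡ (pℤₚ⊆ℤₚ (x∈ 5F)) (y∈ 4F))))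
  Box-Λ-*ₒ x∈ y∈ 4F =
    ∈-⊕ (∈-⊕ (∈-⊗ˡ (y∈ 0F) (x∈ 4F)) (∈-⊗ˡ (y∈ 7F) (y∈ 4F)))
        (∈-⊟ (∈-⊗ˡ (x∈ 2F) (y∈ 3F)) (∈-⊗ˡ (x∈ 3F) (y∈ 2F)))
  Box-Λ-*ₒ x∈ y∈ 5F =
    ∈-⊕ (∈-⊕ (∈-⊗ʳ (y∈ 0F) (x∈ 5F)) (∈-⊗ʳ (y∈ 7F) (y∈ 5F)))
        (∈-⊟ (∈-⊗ʳ (x∈ 3F) (y∈ 1F)) (∈-⊗ˡ (x∈ 1F) (y∈ 3F)))
  Box-Λ-*ₒ x∈ y∈ 6F =
    ∈-⊕ (∈-⊕ (∈-⊗ˡ (y∈ 0F) (x∈ 6F)) (∈-⊗ˡ (y∈ 7F) (y∈ 6F)))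
        (∈-⊟ (∈-⊗ˡ (pℤₚ⊆ℤₚ (x∈ 1F)) (y∈ 2F)) (∈-⊗ˡ (x∈ 2F) (pℤₚ⊆ℤₚ (y∈ 1F))))
  Box-Λ-*ₒ x∈ y∈ 7F =
    ∈-⊕ (∈-⊗ˡ (x∈ 7F) (y∈ 7F))
        (∈-⊕ (∈-⊕ (∈-⊗ˡ (x∈ 4F) (pℤₚ⊆ℤₚ (y∈ 1F))) (∈-⊗ˡ (pℤₚ⊆ℤₚ (x∈ 5F)) (y∈ 2F))) (∈-⊗ˡ (x∈ 6F) (y∈ 3F)))

  Box-Λ*-*ₒ : ∀ {x y} → Box Λ*-scales x → Box Λ*-scales y → Box p⁻¹Λ-scales (x *ₒ y)
  Box-Λ*-*ₒ x∈ y∈ 0F =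
    ∈-⊕ (ℤₚ⊆p⁻¹ℤₚ (∈-⊗ˡ (x∈ 0F) (y∈ 0F)))
        (∈-⊕ (∈-⊕ (∈-⊗ʳ (x∈ 1F) (y∈ 4F)) (∈-⊗ˡ (x∈ 2F) (y∈ 5F))) (ℤₚ⊆p⁻¹ℤₚ (∈-⊗ˡ (x∈ 3F) (y∈ 6F))))
  Box-Λ*-*ₒ x∈ y∈ 1F =
    ∈-⊕ (∈-⊕ (∈-⊗ˡ (x∈ 0F) (y∈ 1F)) (∈-⊗ˡ (y∈ 7F) (x∈ 1F)))
        (∈-⊖ (∈-⊟ (∈-⊗ˡ (x∈ 5F) (y∈ 6F)) (∈-⊗ˡ (x∈ 6F) (y∈ 5F))))
  Box-Λ*-*ₒ x∈ y∈ 2F =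
    ∈-⊕ (∈-⊕ (∈-⊗ʳ (x∈ 0F) (y∈ 2F)) (∈-⊗ʳ (y∈ 7F) (x∈ 2F)))
        (∈-⊖ (∈-⊟ (∈-⊗ʳ (x∈ 6F) (y∈ 4F)) (∈-⊗ˡ (x∈ 4F) (y∈ 6F))))
  Box-Λ*-*ₒ x∈ y∈ 3F =
    ∈-⊕ (∈-⊕ (ℤₚ⊆p⁻¹ℤₚ (∈-⊗ˡ (x∈ 0F) (y∈ 3F))) (ℤₚ⊆p⁻¹ℤₚ (∈-⊗ˡ (y∈ 7F) (x∈ 3F))))
        (∈-⊖ (∈-⊟ (∈-⊗ˡ (x∈ 4F) (y∈ 5F)) (∈-⊗ʳ (x∈ 5F) (y∈ 4F))))
  Box-Λ*-*ₒ x∈ y∈ 4F =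
    ∈-⊕ (∈-⊕ (∈-⊗ʳ (y∈ 0F) (x∈ 4F)) (∈-⊗ʳ (y∈ 7F) (y∈ 4F)))
        (∈-⊟ (∈-⊗ˡ (x∈ 2F) (y∈ 3F)) (∈-⊗ʳ (x∈ 3F) (y∈ 2F)))
  Box-Λ*-*ₒ x∈ y∈ 5F =
    ∈-⊕ (∈-⊕ (∈-⊗ˡ (y∈ 0F) (x∈ 5F)) (∈-⊗ˡ (y∈ 7F) (y∈ 5F)))
        (∈-⊟ (∈-⊗ˡ (x∈ 3F) (y∈ 1F)) (∈-⊗ˡ (x∈ 1F) (y∈ 3F)))
  Box-Λ*-*ₒ x∈ y∈ 6F =
    ∈-⊕ (∈-⊕ (ℤₚ⊆p⁻¹ℤₚ (∈-⊗ˡ (y∈ 0F) (x∈ 6F))) (ℤₚ⊆p⁻¹ℤₚ (∈-⊗ˡ (y∈ 7F) (y∈ 6F))))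
        (∈-⊟ (∈-⊗ʳ (x∈ 1F) (y∈ 2F)) (∈-⊗ˡ (x∈ 2F) (y∈ 1F)))
  Box-Λ*-*ₒ x∈ y∈ 7F =
    ∈-⊕ (ℤₚ⊆p⁻¹ℤₚ (∈-⊗ˡ (x∈ 7F) (y∈ 7F)))
        (∈-⊕ (∈-⊕ (∈-⊗ˡ (x∈ 4F) (y∈ 1F)) (∈-⊗ʳ (x∈ 5F) (y∈ 2F))) (ℤₚ⊆p⁻¹ℤₚ (∈-⊗ˡ (x∈ 6F) (y∈ 3F))))

  Λ₀⊆Box : Λ₀ ⊆ Box Λ-scales
  Λ₀⊆Box x (x₁ , x₂ , x₃ , x₄ , x₅ , x₆ , x₇ , x₈) = λ where
    0F → InZp⇒∈ℤₚ x₁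
    1F → InPZp⇒∈pℤₚ x₂
    2F → InZp⇒∈ℤₚ x₃
    3F → InZp⇒∈ℤₚ x₄
    4F → InZp⇒∈ℤₚ x₅
    5F → InPZp⇒∈pℤₚ x₆
    6F → InZp⇒∈ℤₚ x₇
    7F → InZp⇒∈ℤₚ x₈

  Box⊆Λ₀ : Box Λ-scales ⊆ Λ₀
  Box⊆Λ₀ x x∈ = ∈ℤₚ⇒InZp (x∈ 0F) , ∈pℤₚ⇒InPZp (x∈ 1F) , ∈ℤₚ⇒InZp (x∈ 2F) , ∈ℤₚ⇒InZp (x∈ 3F) ,
                ∈ℤₚ⇒InZp (x∈ 4F) , ∈pℤₚ⇒InPZp (x∈ 5F) , ∈ℤₚ⇒InZp (x∈ 6F) , ∈ℤₚ⇒InZp (x∈ 7F)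

  Λ-scales-invertible : ∀ i → ∃ λ u → u ⊗ coord i Λ-scales ≃ 1q
  Λ-scales-invertible = λ where
    0F → 1q , 1⊗1
    1F → p⁻¹ , p⁻¹⊗p
    2F → 1q , 1⊗1
    3F → 1q , 1⊗1
    4F → 1q , 1⊗1
    5F → p⁻¹ , p⁻¹⊗p
    6F → 1q , 1⊗1
    7F → 1q , 1⊗1

  Λ*-Λ-pairing : ∀ j → coord j Λ*-scales ⊗ coord (σ j) Λ-scales ≃ 1q
  Λ*-Λ-pairing = λ where
    0F → 1⊗1
    1F → 1⊗1
    2F → p⁻¹⊗p
    3F → 1⊗1
    4F → p⁻¹⊗p
    5F → 1⊗1
    6F → 1⊗1
    7F → 1⊗1

  Λ-scales≤Λ*-scales : ∀ i → coord i Λ-scales ∈ coord i Λ*-scales ·ℤₚ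
  Λ-scales≤Λ*-scales = λ where
    0F → ∈-self 1q
    1F → p∈ℤₚ
    2F → 1∈p⁻¹ℤₚ
    3F → ∈-self 1q
    4F → 1∈p⁻¹ℤₚ
    5F → p∈ℤₚ
    6F → ∈-self 1q
    7F → ∈-self 1q

  Λ*-scales≤p⁻¹Λ-scales : ∀ i → coord i Λ*-scales ∈ coord i p⁻¹Λ-scales ·ℤₚ
  Λ*-scales≤p⁻¹Λ-scales = λ where
    0F → 1∈p⁻¹ℤₚ
    1F → ∈-self 1q
    2F → ∈-self p⁻¹
    3F → 1∈p⁻¹ℤₚ
    4F → ∈-self p⁻¹
    5F → ∈-self 1q
    6F → 1∈p⁻¹ℤₚ
    7F → 1∈p⁻¹ℤₚ

  p·p⁻¹Λ-scales≤Λ-scales : ∀ i → coord i (pq ·ₒ p⁻¹Λ-scales) ∈ coord i Λ-scales ·ℤₚ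
  p·p⁻¹Λ-scales≤Λ-scales = λ where
    0F → p⊗p⁻¹∈ℤₚ
    1F → p⊗1∈pℤₚ
    2F → p⊗p⁻¹∈ℤₚ
    3F → p⊗p⁻¹∈ℤₚ
    4F → p⊗p⁻¹∈ℤₚ
    5F → p⊗1∈pℤₚ
    6F → p⊗p⁻¹∈ℤₚ
    7F → p⊗p⁻¹∈ℤₚ

  Λ₀*⊆Box : Dual Λ₀ ⊆ Box Λ*-scales
  Λ₀*⊆Box x x∈ = Dual⊆Box Λ*-Λ-pairing x (Dual-antitone Box⊆Λ₀ x x∈)

  Box⊆Λ₀* : Box Λ*-scales ⊆ Dual Λ₀
  Box⊆Λ₀* x x∈ = Dual-antitone Λ₀⊆Box x (Box⊆Dual Λ*-Λ-pairing x x∈)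

  Box⊆p⁻¹Λ₀ : Box p⁻¹Λ-scales ⊆ pInv Λ₀
  Box⊆p⁻¹Λ₀ x x∈ = Box⊆Λ₀ (pq ·ₒ x) (Box-widen p·p⁻¹Λ-scales≤Λ-scales (pq ·ₒ x) (Box-scale (∈-self pq) x∈))

  Λ₀-isOrder : IsOrder Λ₀
  Λ₀-isOrder =
    IsLattice-resp Box⊆Λ₀ Λ₀⊆Box (Box-isLattice Λ-scales Λ-scales-invertible) ,
    Box⊆Λ₀ 1ₒ 1∈Box ,
    λ x y x∈ y∈ → Box⊆Λ₀ (x *ₒ y) (Box-Λ-*ₒ (Λ₀⊆Box x x∈) (Λ₀⊆Box y y∈))
    where
    1∈Box : Box Λ-scales 1ₒ
    1∈Box = λ where
      0F → ∈-self 1q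
      7F → ∈-self 1q
      1F → ∈-0
      2F → ∈-0
      3F → ∈-0
      4F → ∈-0
      5F → ∈-0
      6F → ∈-0

  Λ₀⊊Λ₀* : 1 ℕ.< p → Λ₀ ⊊ Dual Λ₀
  Λ₀⊊Λ₀* 1<p =
    (λ x x∈ → Box⊆Λ₀* x (Box-widen Λ-scales≤Λ*-scales x (Λ₀⊆Box x x∈))) ,
    w , Box⊆Λ₀* w (basisVector∈Box Λ*-scales 2F) ,
    λ w∈ → p⁻¹∉ℤₚ 1<p (∈-resp (*-identityʳ p⁻¹) (Λ₀⊆Box w w∈ 2F))
    where w = basisVector Λ*-scales 2F

  Λ₀*⊊p⁻¹Λ₀ : 1 ℕ.< p → Dual Λ₀ ⊊ pInv Λ₀
  Λ₀*⊊p⁻¹Λ₀ 1<p =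
    (λ x x∈ → Box⊆p⁻¹Λ₀ x (Box-widen Λ*-scales≤p⁻¹Λ-scales x (Λ₀*⊆Box x x∈))) ,
    w , Box⊆p⁻¹Λ₀ w (basisVector∈Box p⁻¹Λ-scales 0F) ,
    λ w∈ → p⁻¹∉ℤₚ 1<p (∈-resp (*-identityʳ p⁻¹) (Λ₀*⊆Box w w∈ 0F))
    where w = basisVector p⁻¹Λ-scales 0F

  Λ₀*²⊆p⁻¹Λ₀ : DualSq Λ₀ ⊆ pInv Λ₀
  Λ₀*²⊆p⁻¹Λ₀ z z∈ = Box⊆p⁻¹Λ₀ z (DualSq⊆Box (λ {x} {y} x∈ y∈ → Box-Λ*-*ₒ (Λ₀*⊆Box x x∈) (Λ₀*⊆Box y y∈)) z z∈)

mainTheorem14 : (p : ℕ) .{{nz : NonZero p}} → Prime p → p ≢ 2 →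
    let open Zorn p in
    IsOrder Λ₀ ×
    ((Λ₀ ⊊ Dual Λ₀) × (Dual Λ₀ ⊊ pInv Λ₀)) ×
    (DualSq Λ₀ ⊆ pInv Λ₀)
mainTheorem14 p p-prime _ = Λ₀-isOrder p , (Λ₀⊊Λ₀* p 1<p , Λ₀*⊊p⁻¹Λ₀ p 1<p) , Λ₀*²⊆p⁻¹Λ₀ p
  where
  -- Primality is used only through p > 1.
  1<p : 1 ℕ.< p
  1<p = ℕ.nonTrivial⇒n>1 p {{prime⇒nonTrivial p-prime}}
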